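{- Let $\mathbf u,\mathbf v\in\mathbb{Z}_2^\alpha\times\mathbb{Z}_4^\beta$ with associated polynomials $\mathbf u(x)=(u(x)\mid u'(x))$ and $\mathbf v(x)=(v(x)\mid v'(x))$. Then $\mathbf u$ is orthogonal to $\mathbf v$ and to all cyclic shifts of $\mathbf v$ if and only if $\mathbf u(x)\circ\mathbf v(x)=0$.
   Context: For $\mathbf u=(u_0,\dots,u_{\alpha-1}\mid u'_0,\dots,u'_{\beta-1})$ the associated polynomial is $(\sum u_ix^i\mid\sum u'_jx^j)\in R_{\alpha,\beta}=\mathbb{Z}_2[x]/(x^\alpha-1)\times\mathbb{Z}_4[x]/(x^\beta-1)$. The $i$th cyclic shift is $\mathbf v^{(i)}=(v_{i},\dots,v_{\alpha-1+i}\mid v'_{i},\dots,v'_{\beta-1+i})$ with indices mod $\alpha$ and mod $\beta$ respectively. Inner product: $\mathbf u\cdot\mathbf v=2\sum_{i}u_iv_i+\sum_j u'_jv'_j\in\mathbb{Z}_4$, binary entries viewed as $0,1\in\mathbb{Z}_4$; orthogonal means inner product $0$. Let $\mathfrak m=\mathrm{lcm}(\alpha,\beta)$, $\theta_m(x)=\sum_{i=0}^{m-1}x^i$, and $p^*(x)=x^{\deg p}p(x^{ -1})$ the reciprocal polynomial. Define $\circ:R_{\alpha,\beta}\times R_{\alpha,\beta}\to\mathbb{Z}_4[x]/(x^{\mathfrak m}-1)$ by $$\mathbf u(x)\circ\mathbf v(x)=2u(x)\theta_{\mathfrak m/\alpha}(x^\alpha)x^{\mathfrak m-1-\deg v}v^*(x)+u'(x)\theta_{\mathfrak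 m/\beta}(x^\beta)x^{\mathfrak m-1-\deg v'}v'^*(x)\bmod (x^{\mathfrak m}-1),$$ where binary $0,1$ in $u,v$ are read as $0,1\in\mathbb{Z}_4$ (polynomials taken of degree less than $\alpha$, resp. $\beta$). -}

module Defs where

open import Data.Nat using (ℕ; zero; suc; _+_; _*_; _∸_; _/_; _%_; NonZero; _≡ᵇ_)
open import Data.Nat.LCM using (lcm)
open import Data.Nat.DivMod using (_mod_)
open import Data.Fin using (Fin; toℕ)
open import Data.Bool using (if_then_else_)
open import Data.Nat.ListAction using (sum)
open import Data.Maybe using (Maybe; just; nothing; fromMaybe)
open import Data.List using (List; []; _∷_; _++_; [_]; map; replicate; reverse; take; tabulate; foldr; upTo)

record Z2Z4 (α β : ℕ) : Set where
  constructor _∣_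
  field
    bin  : Fin α → Fin 2
    quat : Fin β → Fin 4
open Z2Z4 public

innerℕ : ∀ {α β} → Z2Z4 α β → Z2Z4 α β → ℕ
innerℕ {α} {β} u v =
  2 * sum (tabulate (λ i → toℕ (bin u i) * toℕ (bin v i)))
  + sum (tabulate (λ j → toℕ (quat u j) * toℕ (quat v j)))

Orthogonal : ∀ {α β} → Z2Z4 α β → Z2Z4 α β → Set
Orthogonal u v = innerℕ u v % 4 ≡ 0
  where open import Relation.Binary.PropositionalEquality using (_≡_)

shift : ∀ {α β} .{{_ : NonZero α}} .{{_ : NonZero β}} → ℕ → Z2Z4 α β → Z2Z4 α β
shift {α} {β} i v =
  (λ j → bin v ((toℕ j + i) mod α)) ∣ (λ j → quat v ((toℕ j + i) mod β))

-- Polynomials with ℕ coefficients (low degree first); they are read in ℤ₄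
-- and finally reduced into ℤ₄[x]/(x^m - 1).

Poly : Set
Poly = List ℕ

_+ₚ_ : Poly → Poly → Poly
[] +ₚ q = q
(a ∷ p) +ₚ [] = a ∷ p
(a ∷ p) +ₚ (b ∷ q) = (a + b) ∷ (p +ₚ q)

scaleₚ : ℕ → Poly → Poly
scaleₚ c = map (c *_)

_*ₚ_ : Poly → Poly → Poly
[] *ₚ q = []
(a ∷ p) *ₚ q = scaleₚ a q +ₚ (0 ∷ (p *ₚ q))

xpow : ℕ → Poly
xpow k = replicate k 0 ++ [ 1 ]

θ : ℕ → ℕ → Poly
θ n a = foldr _+ₚ_ [] (map (λ i → xpow (a * i)) (upTo n))

degM : Poly → Maybe ℕ
degM [] = nothing
degM (a ∷ p) with degM p
... | just d = just (suc d)
... | nothing = if (a % 4) ≡ᵇ 0 then nothing else just 0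

-- convention: deg 0 = 0 (irrelevant: then p* = 0)
deg : Poly → ℕ
deg p = fromMaybe 0 (degM p)

-- reciprocal polynomial p*(x) = x^{deg p} p(x^{-1})
recip : Poly → Poly
recip p = reverse (take (suc (deg p)) p)

binPoly : ∀ {α} → (Fin α → Fin 2) → Poly
binPoly u = tabulate (λ i → toℕ (u i))

quatPoly : ∀ {β} → (Fin β → Fin 4) → Poly
quatPoly u = tabulate (λ i → toℕ (u i))

𝔪 : ℕ → ℕ → ℕ
𝔪 = lcm

-- u(x) ∘ v(x), as a polynomial in ℤ[x] (to be reduced mod 4 and mod x^𝔪 - 1)
circ : ∀ {α β} .{{_ : NonZero α}} .{{_ : NonZero β}} → Z2Z4 α β → Z2Z4 α β → Poly
circ {α} {β} u v =
  scaleₚ 2 (binPoly (bin u) *ₚ (θ (m / α) α *ₚ (xpow (m ∸ 1 ∸ deg vb) *ₚ recip vb)))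
  +ₚ (quatPoly (quat u) *ₚ (θ (m / β) β *ₚ (xpow (m ∸ 1 ∸ deg vq) *ₚ recip vq)))
  where
  m = 𝔪 α β
  vb = binPoly (bin v)
  vq = quatPoly (quat v)

-- coefficient of x^k (k < m) of the image of p in ℤ[x]/(x^m - 1):
-- sum of p_i over i ≡ k (mod m); c tracks i mod m
redAux : ℕ → ℕ → Poly → ℕ → ℕ
redAux m c [] k = 0
redAux m c (a ∷ p) k =
  (if c ≡ᵇ k then a else 0) + redAux m (if suc c ≡ᵇ m then 0 else suc c) p k

IsZeroMod : ℕ → Poly → Set
IsZeroMod m p = ∀ k → k < m → redAux m 0 p k % 4 ≡ 0
  where open import Relation.Binary.PropositionalEquality using (_≡_)
        open import Data.Nat using (_<_)

module Submission where

-- Write M = 𝔪 α β and, for k < M, read off the coefficient of x^k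
-- of u(x) ∘ v(x) in ℤ[x]/(x^M - 1) before reducing mod 4.  The central identity
-- (circ-coefficient) says that this natural number *equals* the inner product
-- of u with the cyclic shift of v by M-1-k; both directions of the theorem then
-- follow at once, because shifts only matter modulo M (inner-shift-mod) and
-- k ↦ M-1-k is a bijection of {0,…,M-1}.
--
-- For each of the two halves f(x)·θ_{M/a}(x^a)·x^{M-1-deg g} g*(x) of ∘
-- (a = α or β) the identity is obtained in four steps:
--   * reduction mod x^M - 1 is linear and turns products into convolutions
--     (module Reduction);
--   * the padded reciprocal x^{M-1-deg g} g* is g reversed inside a window of
--     length M, so reducing it reads g backwards (PaddedReciprocal, R-padded);
--   * multiplying by θ_{M/a}(x^a) sums over an orbit of step a mod M, which
--     collapses to a single value of g at an index mod a (orbit-sum);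
--   * convolving with f then gives Σⱼ fⱼ g_{(j+M-1-k) mod a} (half-product).

open import Defs
open import Data.Bool using (true; false; if_then_else_; T)
open import Data.Bool.Properties using (if-eta)
open import Data.Empty using (⊥-elim)
open import Data.Fin using (Fin; toℕ) renaming (zero to fzero; suc to fsuc)
open import Data.Fin.Properties using (toℕ-fromℕ<; toℕ-injective; toℕ<n)
open import Data.List using (List; []; _∷_; _++_; [_]; map; reverse; take; tabulate; foldr; applyUpTo; length)
open import Data.List.Properties using (tabulate-cong; length-tabulate; unfold-reverse; length-reverse; length-take)
open import Data.Maybe using (Maybe; just; nothing)
open import Data.Nat
open import Data.Nat.DivMod
open import Data.Nat.Divisibility using (∣⇒≤) renaming (_∣_ to _∣ℕ_)
open import Data.Nat.GCD using (gcd)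
open import Data.Nat.LCM using (lcm; gcd*lcm; m∣lcm[m,n]; n∣lcm[m,n])
open import Data.Nat.ListAction using (sum)
open import Data.Nat.Properties
open import Algebra.Properties.CommutativeSemigroup +-commutativeSemigroup using (interchange)
open import Data.Nat.Tactic.RingSolver using (solve-∀)
open import Data.Unit using (tt)
open import Function using (_∘_; id)
open import Function.Bundles using (_⇔_; mk⇔)
open import Relation.Binary.PropositionalEquality hiding ([_])
open import Relation.Nullary using (yes; no)

sumTo : ℕ → (ℕ → ℕ) → ℕ
sumTo zero    f = 0
sumTo (suc n) f = f 0 + sumTo n (f ∘ suc)

sumTo-cong : ∀ n f g → (∀ r → r < n → f r ≡ g r) → sumTo n f ≡ sumTo n g
sumTo-cong zero    f g eq = refl
sumTo-cong (suc n) f g eq =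
  cong₂ _+_ (eq 0 z<s) (sumTo-cong n _ _ (λ r r<n → eq (suc r) (s<s r<n)))

sumTo-vanishing : ∀ n f → (∀ r → r < n → f r ≡ 0) → sumTo n f ≡ 0
sumTo-vanishing zero    f eq = refl
sumTo-vanishing (suc n) f eq =
  cong₂ _+_ (eq 0 z<s) (sumTo-vanishing n _ (λ r r<n → eq (suc r) (s<s r<n)))

sumTo-rotate : ∀ n f → sumTo n (f ∘ suc) + f 0 ≡ sumTo n f + f n
sumTo-rotate zero    f = refl
sumTo-rotate (suc n) f = begin
    (f 1 + sumTo n (f ∘ suc ∘ suc)) + f 0
  ≡⟨ cong (_+ f 0) (+-comm (f 1) _) ⟩
    (sumTo n (f ∘ suc ∘ suc) + f 1) + f 0
  ≡⟨ cong (_+ f 0) (sumTo-rotate n (f ∘ suc)) ⟩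
    (sumTo n (f ∘ suc) + f (suc n)) + f 0
  ≡⟨ swap (sumTo n (f ∘ suc)) (f (suc n)) (f 0) ⟩
    (f 0 + sumTo n (f ∘ suc)) + f (suc n) ∎
  where
  open ≡-Reasoning
  swap : ∀ a b c → (a + b) + c ≡ (c + a) + b
  swap = solve-∀

sumTo-periodic : ∀ n g → (∀ r → g (r + n) ≡ g r) → ∀ q → sumTo n (λ r → g (r + q)) ≡ sumTo n g
sumTo-periodic n g per zero    = sumTo-cong n _ _ (λ r _ → cong g (+-identityʳ r))
sumTo-periodic n g per (suc q) = begin
    sumTo n (λ r → g (r + suc q))
  ≡⟨ sumTo-cong n _ _ (λ r _ → cong g (+-suc r q)) ⟩
    sumTo n (λ r → g (suc r + q))
  ≡⟨ +-cancelʳ-≡ (g q) _ _ rotated ⟩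
    sumTo n (λ r → g (r + q))
  ≡⟨ sumTo-periodic n g per q ⟩
    sumTo n g ∎
  where
  open ≡-Reasoning
  rotated : sumTo n (λ r → g (suc r + q)) + g q ≡ sumTo n (λ r → g (r + q)) + g q
  rotated = trans (sumTo-rotate n (λ r → g (r + q)))
                  (cong (sumTo n (λ r → g (r + q)) +_) (trans (cong g (+-comm n q)) (per q)))

coeff : Poly → ℕ → ℕ
coeff []      _       = 0
coeff (a ∷ p) zero    = a
coeff (a ∷ p) (suc i) = coeff p i

coeff-+ₚ : ∀ p q i → coeff (p +ₚ q) i ≡ coeff p i + coeff q i
coeff-+ₚ []      q       i       = refl
coeff-+ₚ (a ∷ p) []      i       = sym (+-identityʳ _)
coeff-+ₚ (a ∷ p) (b ∷ q) zero    = refl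
coeff-+ₚ (a ∷ p) (b ∷ q) (suc i) = coeff-+ₚ p q i

coeff-scaleₚ : ∀ c p i → coeff (scaleₚ c p) i ≡ c * coeff p i
coeff-scaleₚ c []      i       = sym (*-zeroʳ c)
coeff-scaleₚ c (a ∷ p) zero    = refl
coeff-scaleₚ c (a ∷ p) (suc i) = coeff-scaleₚ c p i

coeff-beyond : ∀ p i → length p ≤ i → coeff p i ≡ 0
coeff-beyond []      i       _         = refl
coeff-beyond (a ∷ p) (suc i) (s≤s le) = coeff-beyond p i le

coeff-x*ₚ : ∀ p q i → coeff ((0 ∷ p) *ₚ q) i ≡ coeff (0 ∷ (p *ₚ q)) i
coeff-x*ₚ p q i =
  trans (coeff-+ₚ (scaleₚ 0 q) _ i) (cong (_+ coeff (0 ∷ (p *ₚ q)) i) (coeff-scaleₚ 0 q i))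

coeff-1*ₚ : ∀ q i → coeff (xpow 0 *ₚ q) i ≡ coeff q i
coeff-1*ₚ q i = begin
    coeff (scaleₚ 1 q +ₚ (0 ∷ [])) i
  ≡⟨ coeff-+ₚ (scaleₚ 1 q) (0 ∷ []) i ⟩
    coeff (scaleₚ 1 q) i + coeff (0 ∷ []) i
  ≡⟨ cong₂ _+_ (trans (coeff-scaleₚ 1 q i) (*-identityˡ _)) (coeff-zero i) ⟩
    coeff q i + 0
  ≡⟨ +-identityʳ _ ⟩
    coeff q i ∎
  where
  open ≡-Reasoning
  coeff-zero : ∀ i → coeff (0 ∷ []) i ≡ 0
  coeff-zero zero    = refl
  coeff-zero (suc i) = refl

coeff-xpow*ₚ-below : ∀ e q i → i < e → coeff (xpow e *ₚ q) i ≡ 0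
coeff-xpow*ₚ-below (suc e) q zero    _         = coeff-x*ₚ (xpow e) q zero
coeff-xpow*ₚ-below (suc e) q (suc i) (s≤s lt) =
  trans (coeff-x*ₚ (xpow e) q (suc i)) (coeff-xpow*ₚ-below e q i lt)

coeff-xpow*ₚ-above : ∀ e q i → coeff (xpow e *ₚ q) (e + i) ≡ coeff q i
coeff-xpow*ₚ-above zero    q i = coeff-1*ₚ q i
coeff-xpow*ₚ-above (suc e) q i =
  trans (coeff-x*ₚ (xpow e) q (suc (e + i))) (coeff-xpow*ₚ-above e q i)

coeff-++-left : ∀ p q i → i < length p → coeff (p ++ q) i ≡ coeff p i
coeff-++-left (a ∷ p) q zero    _         = refl
coeff-++-left (a ∷ p) q (suc i) (s≤s lt) = coeff-++-left p q i lt

coeff-++-right : ∀ p q i → coeff (p ++ q) (length p + i) ≡ coeff q i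
coeff-++-right []      q i = refl
coeff-++-right (a ∷ p) q i = coeff-++-right p q i

coeff-reverse : ∀ L i j → suc (i + j) ≡ length L → coeff (reverse L) i ≡ coeff L j
coeff-reverse (a ∷ L) i j eq rewrite unfold-reverse a L = by-j j eq
  where
  -- j = 0 is the entry a appended last by reverse; otherwise recurse into L
  by-j : ∀ j → suc (i + j) ≡ suc (length L) → coeff (reverse L ++ [ a ]) i ≡ coeff (a ∷ L) j
  by-j zero eq = trans (cong (coeff (reverse L ++ [ a ])) i≡) (coeff-++-right (reverse L) [ a ] 0)
    where
    i≡ : i ≡ length (reverse L) + 0
    i≡ = trans (trans (sym (+-identityʳ i)) (suc-injective eq))
               (trans (sym (length-reverse L)) (sym (+-identityʳ _)))
  by-j (suc j) eq = trans (coeff-++-left (reverse L) [ a ] i lt) (coeff-reverse L i j eq′)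
    where
    eq′ : suc (i + j) ≡ length L
    eq′ = trans (sym (+-suc i j)) (suc-injective eq)
    lt : i < length (reverse L)
    lt = subst (i <_) (sym (length-reverse L)) (subst (i <_) eq′ (s≤s (m≤m+n i j)))

coeff-take : ∀ n p i → i < n → coeff (take n p) i ≡ coeff p i
coeff-take (suc n) []      i       _         = refl
coeff-take (suc n) (a ∷ p) zero    _         = refl
coeff-take (suc n) (a ∷ p) (suc i) (s≤s lt) = coeff-take n p i lt

coeff-tabulate : ∀ n (g : Fin n → ℕ) x → coeff (tabulate g) (toℕ x) ≡ g x
coeff-tabulate (suc n) g fzero    = refl
coeff-tabulate (suc n) g (fsuc x) = coeff-tabulate n (g ∘ fsuc) x

coeff-tabulate-<4 : ∀ n (g : Fin n → ℕ) → (∀ x → g x < 4) → ∀ j → coeff (tabulate g) j < 4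
coeff-tabulate-<4 zero    g bound j       = s≤s z≤n
coeff-tabulate-<4 (suc n) g bound zero    = bound fzero
coeff-tabulate-<4 (suc n) g bound (suc j) = coeff-tabulate-<4 n (g ∘ fsuc) (bound ∘ fsuc) j

data DegreeView (p : Poly) : Maybe ℕ → Set where
  zero-poly : (∀ j → coeff p j % 4 ≡ 0) → DegreeView p nothing
  of-degree : ∀ d → d < length p → (∀ j → d < j → coeff p j % 4 ≡ 0) → DegreeView p (just d)

degreeView : ∀ p → DegreeView p (degM p)
degreeView [] = zero-poly (λ _ → refl)
degreeView (a ∷ p) with degM p | degreeView p
... | just d  | of-degree .d lt above = of-degree (suc d) (s≤s lt) λ { (suc j) (s≤s le) → above j le }
... | nothing | zero-poly all with a % 4 ≡ᵇ 0 in eq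
...   | true  = zero-poly λ { zero → ≡ᵇ⇒≡ _ _ (subst T (sym eq) tt) ; (suc j) → all j }
...   | false = of-degree 0 (s≤s z≤n) λ { (suc j) _ → all j }

deg<length : ∀ p → 0 < length p → deg p < length p
deg<length p pos with degM p | degreeView p
... | just d  | of-degree .d lt _ = lt
... | nothing | zero-poly _        = pos

coeff-above-deg : ∀ p j → deg p < j → coeff p j % 4 ≡ 0
coeff-above-deg p j lt with degM p | degreeView p
... | just d  | of-degree .d _ above = above j lt
... | nothing | zero-poly all        = all j

next : ℕ → ℕ → ℕ
next m c = if suc c ≡ᵇ m then 0 else suc c

module Residues (M : ℕ) {{_ : NonZero M}} where

  M∸1+1 : 1 + (M ∸ 1) ≡ M
  M∸1+1 = m+[n∸m]≡n (>-nonZero⁻¹ M)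

  M∸1<M : M ∸ 1 < M
  M∸1<M = subst (M ∸ 1 <_) M∸1+1 (n<1+n (M ∸ 1))

  <M⇒≤M∸1 : ∀ {x} → x < M → x ≤ M ∸ 1
  <M⇒≤M∸1 lt = ≤-pred (subst (_ <_) (sym M∸1+1) lt)

  %-absorbˡ : ∀ x y → (x % M + y) % M ≡ (x + y) % M
  %-absorbˡ x y = begin
      (x % M + y) % M
    ≡⟨ %-distribˡ-+ (x % M) y M ⟩
      (x % M % M + y % M) % M
    ≡⟨ cong (λ t → (t + y % M) % M) (m%n%n≡m%n x M) ⟩
      (x % M + y % M) % M
    ≡⟨ sym (%-distribˡ-+ x y M) ⟩
      (x + y) % M ∎
    where open ≡-Reasoning

  %-absorbʳ : ∀ x y → (x + y % M) % M ≡ (x + y) % M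
  %-absorbʳ x y =
    trans (cong (_% M) (+-comm x (y % M))) (trans (%-absorbˡ y x) (cong (_% M) (+-comm y x)))

  suc-% : ∀ {c} → suc c % M ≡ suc (c % M) % M
  suc-% {c} = sym (%-absorbʳ 1 c)

  -- The redAux counter started at c % M is always the current exponent mod M.
  next-% : ∀ c → next M (c % M) ≡ suc c % M
  next-% c with suc (c % M) ≡ᵇ M in eq
  ... | true  = sym (trans suc-% (trans (cong (_% M) wraps) (n%n≡0 M)))
    where
    wraps : suc (c % M) ≡ M
    wraps = ≡ᵇ⇒≡ _ _ (subst T (sym eq) tt)
  ... | false = sym (trans suc-% (m<n⇒m%n≡m (≤∧≢⇒< (m%n<n c M) stays)))
    where
    stays : suc (c % M) ≢ M
    stays e = subst T (trans (sym (cong (_≡ᵇ M) e)) eq) (≡⇒≡ᵇ M M refl)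

  %-cancelʳ-+ : ∀ x y z → (x + z) % M ≡ (y + z) % M → x % M ≡ y % M
  %-cancelʳ-+ x y z eq = begin
      x % M
    ≡⟨ sym ([m+kn]%n≡m%n x (suc (z / M)) M) ⟩
      (x + suc (z / M) * M) % M
    ≡⟨ cong (_% M) (sym (complete x)) ⟩
      (x + z + w) % M
    ≡⟨ sym (%-absorbˡ (x + z) w) ⟩
      ((x + z) % M + w) % M
    ≡⟨ cong (λ t → (t + w) % M) eq ⟩
      ((y + z) % M + w) % M
    ≡⟨ %-absorbˡ (y + z) w ⟩
      (y + z + w) % M
    ≡⟨ cong (_% M) (complete y) ⟩
      (y + suc (z / M) * M) % M
    ≡⟨ [m+kn]%n≡m%n y (suc (z / M)) M ⟩
      y % M ∎
    where
    open ≡-Reasoning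
    -- w tops z up to the next multiple of M
    w = M ∸ z % M
    regroup : ∀ x s q w m → x + (s + q * m) + w ≡ x + ((s + w) + q * m)
    regroup = solve-∀
    complete : ∀ x → x + z + w ≡ x + suc (z / M) * M
    complete x = begin
        x + z + w
      ≡⟨ cong (λ t → x + t + w) (m≡m%n+[m/n]*n z M) ⟩
        x + (z % M + z / M * M) + w
      ≡⟨ regroup x (z % M) (z / M) w M ⟩
        x + ((z % M + w) + z / M * M)
      ≡⟨ cong (λ t → x + (t + z / M * M)) (m+[n∸m]≡n (m%n≤n z M)) ⟩
        x + suc (z / M) * M ∎

  rotation-moves : ∀ c j → c < M → suc j < M → (c + suc j) % M ≢ c
  rotation-moves c j c<M j<M eq = 1+n≢0 (trans (sym (m<n⇒m%n≡m j<M)) (trans (%-cancelʳ-+ (suc j) 0 c eq′) (m<n⇒m%n≡m (>-nonZero⁻¹ M))))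
    where
    eq′ : (suc j + c) % M ≡ (0 + c) % M
    eq′ = trans (cong (_% M) (+-comm (suc j) c)) (trans eq (sym (m<n⇒m%n≡m c<M)))

  orbit-sum : ∀ a n {{_ : NonZero a}} → n * a ≡ M → (f : ℕ → ℕ) → (∀ j → a ≤ j → f j ≡ 0) →
              ∀ x → sumTo n (λ r → f ((x + a * r) % M)) ≡ f (x % a)
  orbit-sum a zero     na f small x = ⊥-elim (≢-nonZero⁻¹ M (sym na))
  orbit-sum a (suc n′) na f small x = begin
      sumTo n (λ r → f ((x + a * r) % M))
    ≡⟨ sumTo-cong n _ _ (λ r _ → cong (λ t → f (t % M)) (split r)) ⟩
      sumTo n (λ r → g (r + x / a))
    ≡⟨ sumTo-periodic n g g-periodic (x / a) ⟩
      g 0 + sumTo n′ (g ∘ suc)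
    ≡⟨ cong₂ _+_ g-start (sumTo-vanishing n′ _ g-rest) ⟩
      f ρ + 0
    ≡⟨ +-identityʳ _ ⟩
      f ρ ∎
    where
    open ≡-Reasoning
    n = suc n′
    ρ = x % a
    -- the orbit, indexed from the representative ρ < a of x
    g : ℕ → ℕ
    g s = f ((ρ + s * a) % M)
    regroup : ∀ ρ q a r → (ρ + q * a) + a * r ≡ ρ + (r + q) * a
    regroup = solve-∀
    split : ∀ r → x + a * r ≡ ρ + (r + x / a) * a
    split r = trans (cong (_+ a * r) (m≡m%n+[m/n]*n x a)) (regroup ρ (x / a) a r)
    distrib : ∀ ρ r n a → ρ + (r + n) * a ≡ (ρ + r * a) + n * a
    distrib = solve-∀
    g-periodic : ∀ r → g (r + n) ≡ g r
    g-periodic r = cong f (trans (cong (_% M) (trans (distrib ρ r n a) (cong ((ρ + r * a) +_) na)))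
                                 ([m+n]%n≡m%n (ρ + r * a) M))
    ρ<a : ρ < a
    ρ<a = m%n<n x a
    g-start : g 0 ≡ f ρ
    g-start = cong f (trans (cong (_% M) (+-identityʳ ρ))
                  (m<n⇒m%n≡m (subst (ρ <_) na (≤-trans ρ<a (m≤m+n a (n′ * a))))))
    g-rest : ∀ r → r < n′ → g (suc r) ≡ 0
    g-rest r r<n′ = trans (cong f (m<n⇒m%n≡m below-M)) (small _ (≤-trans (m≤m+n a (r * a)) (m≤n+m _ ρ)))
      where
      below-M : ρ + suc r * a < M
      below-M = subst (ρ + suc r * a <_) na (+-mono-<-≤ ρ<a (*-monoˡ-≤ a r<n′))

if-+ : ∀ b x y → (if b then x + y else 0) ≡ (if b then x else 0) + (if b then y else 0)
if-+ true  x y = refl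
if-+ false x y = refl

if-* : ∀ b c x → (if b then c * x else 0) ≡ c * (if b then x else 0)
if-* true  c x = refl
if-* false c x = sym (*-zeroʳ c)

≡ᵇ-true : ∀ c → (c ≡ᵇ c) ≡ true
≡ᵇ-true zero    = refl
≡ᵇ-true (suc c) = ≡ᵇ-true c

if-≡ᵇ-yes : ∀ c d x → c ≡ d → (if c ≡ᵇ d then x else 0) ≡ x
if-≡ᵇ-yes c d x refl rewrite ≡ᵇ-true c = refl

if-≡ᵇ-no : ∀ c d x → c ≢ d → (if c ≡ᵇ d then x else 0) ≡ 0
if-≡ᵇ-no c d x c≢d with c ≡ᵇ d in eq
... | true  = ⊥-elim (c≢d (≡ᵇ⇒≡ c d (subst T (sym eq) tt)))
... | false = refl

module Reduction (M : ℕ) {{_ : NonZero M}} (k : ℕ) where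
  open Residues M

  -- R c p is the coefficient of x^k in x^c · p mod (x^M - 1), for c < M.
  R : ℕ → Poly → ℕ
  R c p = redAux M c p k

  R-+ₚ : ∀ c p q → R c (p +ₚ q) ≡ R c p + R c q
  R-+ₚ c []      q       = refl
  R-+ₚ c (a ∷ p) []      = sym (+-identityʳ _)
  R-+ₚ c (a ∷ p) (b ∷ q) = begin
      (if c ≡ᵇ k then a + b else 0) + R (next M c) (p +ₚ q)
    ≡⟨ cong₂ _+_ (if-+ (c ≡ᵇ k) a b) (R-+ₚ (next M c) p q) ⟩
      ((if c ≡ᵇ k then a else 0) + (if c ≡ᵇ k then b else 0)) + (R (next M c) p + R (next M c) q)
    ≡⟨ interchange (if c ≡ᵇ k then a else 0) _ (R (next M c) p) _ ⟩
      ((if c ≡ᵇ k then a else 0) + R (next M c) p) + ((if c ≡ᵇ k then b else 0) + R (next M c) q) ∎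
    where open ≡-Reasoning

  R-scaleₚ : ∀ c d p → R c (scaleₚ d p) ≡ d * R c p
  R-scaleₚ c d []      = sym (*-zeroʳ d)
  R-scaleₚ c d (a ∷ p) = trans (cong₂ _+_ (if-* (c ≡ᵇ k) d a) (R-scaleₚ (next M c) d p))
                               (sym (*-distribˡ-+ d _ _))

  R-x : ∀ c p → R (c % M) (0 ∷ p) ≡ R (suc c % M) p
  R-x c p = cong₂ _+_ (if-eta (c % M ≡ᵇ k)) (cong (λ t → R t p) (next-% c))

  convolve : Poly → Poly → ℕ → ℕ
  convolve []      q c = 0
  convolve (a ∷ p) q c = a * R (c % M) q + convolve p q (suc c)

  R-*ₚ : ∀ p q c → R (c % M) (p *ₚ q) ≡ convolve p q c
  R-*ₚ []      q c = refl
  R-*ₚ (a ∷ p) q c = begin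
      R (c % M) (scaleₚ a q +ₚ (0 ∷ (p *ₚ q)))
    ≡⟨ R-+ₚ (c % M) (scaleₚ a q) _ ⟩
      R (c % M) (scaleₚ a q) + R (c % M) (0 ∷ (p *ₚ q))
    ≡⟨ cong₂ _+_ (R-scaleₚ (c % M) a q) (R-x c (p *ₚ q)) ⟩
      a * R (c % M) q + R (suc c % M) (p *ₚ q)
    ≡⟨ cong (a * R (c % M) q +_) (R-*ₚ p q (suc c)) ⟩
      a * R (c % M) q + convolve p q (suc c) ∎
    where open ≡-Reasoning

  convolve-+ₚ : ∀ p p′ q c → convolve (p +ₚ p′) q c ≡ convolve p q c + convolve p′ q c
  convolve-+ₚ []      p′       q c = refl
  convolve-+ₚ (a ∷ p) []       q c = sym (+-identityʳ _)
  convolve-+ₚ (a ∷ p) (b ∷ p′) q c = begin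
      (a + b) * R (c % M) q + convolve (p +ₚ p′) q (suc c)
    ≡⟨ cong₂ _+_ (*-distribʳ-+ (R (c % M) q) a b) (convolve-+ₚ p p′ q (suc c)) ⟩
      (a * R (c % M) q + b * R (c % M) q) + (convolve p q (suc c) + convolve p′ q (suc c))
    ≡⟨ interchange (a * R (c % M) q) _ (convolve p q (suc c)) _ ⟩
      (a * R (c % M) q + convolve p q (suc c)) + (b * R (c % M) q + convolve p′ q (suc c)) ∎
    where open ≡-Reasoning

  convolve-xpow : ∀ e q c → convolve (xpow e) q c ≡ R ((c + e) % M) q
  convolve-xpow zero    q c = begin
      1 * R (c % M) q + 0  ≡⟨ +-identityʳ _ ⟩
      1 * R (c % M) q      ≡⟨ *-identityˡ _ ⟩
      R (c % M) q          ≡⟨ cong (λ t → R (t % M) q) (sym (+-identityʳ c)) ⟩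
      R ((c + 0) % M) q    ∎
    where open ≡-Reasoning
  convolve-xpow (suc e) q c =
    trans (convolve-xpow e q (suc c)) (cong (λ t → R (t % M) q) (sym (+-suc c e)))

  convolve-θ : ∀ n a q c → convolve (θ n a) q c ≡ sumTo n (λ r → R ((c + a * r) % M) q)
  convolve-θ n a q c = over-range id n
    where
    over-range : ∀ g n → convolve (foldr _+ₚ_ [] (map (λ i → xpow (a * i)) (applyUpTo g n))) q c
                         ≡ sumTo n (λ r → R ((c + a * g r) % M) q)
    over-range g zero    = refl
    over-range g (suc n) = trans (convolve-+ₚ (xpow (a * g 0)) _ q c)
      (cong₂ _+_ (convolve-xpow (a * g 0) q c) (over-range (g ∘ suc) n))

  convolve-tabulate : ∀ n (f : Fin n → ℕ) q c →
    convolve (tabulate f) q c ≡ sum (tabulate (λ j → f j * R ((c + toℕ j) % M) q))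
  convolve-tabulate zero    f q c = refl
  convolve-tabulate (suc n) f q c =
    cong₂ _+_ (cong (λ t → f fzero * R (t % M) q) (sym (+-identityʳ c)))
      (trans (convolve-tabulate n (f ∘ fsuc) q (suc c))
        (cong sum (tabulate-cong (λ j → cong (λ t → f (fsuc j) * R (t % M) q) (sym (+-suc c (toℕ j)))))))

  VanishesFrom : ℕ → Poly → Set
  VanishesFrom n p = ∀ i → n ≤ i → coeff p i ≡ 0

  vanishes-tail : ∀ a p n → VanishesFrom n (a ∷ p) → VanishesFrom (n ∸ 1) p
  vanishes-tail a p zero    van i _  = van (suc i) z≤n
  vanishes-tail a p (suc n) van i le = van (suc i) (s≤s le)

  R-short : ∀ p n → n ≤ M → VanishesFrom n p →
            ∀ c j → c < M → j < M → (c + j) % M ≡ k → R c p ≡ coeff p j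
  R-short-tail : ∀ a p n → n ≤ M → VanishesFrom n (a ∷ p) →
                 ∀ c j → c < M → j < M → (suc c + j) % M ≡ k → R (next M c) p ≡ coeff p j

  R-short []      n n≤M van c j       c<M j<M hit = refl
  R-short (a ∷ p) n n≤M van c zero    c<M _   hit = begin
      (if c ≡ᵇ k then a else 0) + R (next M c) p
    ≡⟨ cong₂ _+_ (if-≡ᵇ-yes c k a c≡k) (R-short-tail a p n n≤M van c (M ∸ 1) c<M M∸1<M wraps) ⟩
      a + coeff p (M ∸ 1)
    ≡⟨ cong (a +_) (vanishes-tail a p n van (M ∸ 1) (∸-monoˡ-≤ 1 n≤M)) ⟩
      a + 0
    ≡⟨ +-identityʳ a ⟩
      a ∎
    where
    open ≡-Reasoning
    c≡k : c ≡ k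
    c≡k = trans (sym (m<n⇒m%n≡m c<M)) (trans (cong (_% M) (sym (+-identityʳ c))) hit)
    wraps : (suc c + (M ∸ 1)) % M ≡ k
    wraps = begin
      (suc c + (M ∸ 1)) % M    ≡⟨ cong (_% M) (sym (+-suc c (M ∸ 1))) ⟩
      (c + (1 + (M ∸ 1))) % M  ≡⟨ cong (λ t → (c + t) % M) M∸1+1 ⟩
      (c + M) % M              ≡⟨ [m+n]%n≡m%n c M ⟩
      c % M                    ≡⟨ m<n⇒m%n≡m c<M ⟩
      c                        ≡⟨ c≡k ⟩
      k                        ∎
  R-short (a ∷ p) n n≤M van c (suc j) c<M j<M hit = begin
      (if c ≡ᵇ k then a else 0) + R (next M c) p
    ≡⟨ cong₂ _+_ (if-≡ᵇ-no c k a c≢k) (R-short-tail a p n n≤M van c j c<M (<-trans (n<1+n j) j<M) hit′) ⟩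
      0 + coeff p j ∎
    where
    open ≡-Reasoning
    c≢k : c ≢ k
    c≢k c≡k = rotation-moves c j c<M j<M (trans hit (sym c≡k))
    hit′ : (suc c + j) % M ≡ k
    hit′ = trans (cong (_% M) (sym (+-suc c j))) hit

  R-short-tail a p n n≤M van c j c<M j<M hit = begin
      R (next M c) p
    ≡⟨ cong (λ t → R (next M t) p) (sym (m<n⇒m%n≡m c<M)) ⟩
      R (next M (c % M)) p
    ≡⟨ cong (λ t → R t p) (next-% c) ⟩
      R (suc c % M) p
    ≡⟨ R-short p (n ∸ 1) (≤-trans (m∸n≤m n 1) n≤M) (vanishes-tail a p n van)
               (suc c % M) j (m%n<n (suc c) M) j<M (trans (%-absorbˡ (suc c) j) hit) ⟩
      coeff p j ∎
    where open ≡-Reasoning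

module PaddedReciprocal (M a : ℕ) {{_ : NonZero M}} {{_ : NonZero a}} (a≤M : a ≤ M)
                        (g : Fin a → ℕ) (g<4 : ∀ x → g x < 4) where
  open Residues M

  V : Poly
  V = tabulate g

  d : ℕ
  d = deg V

  W : Poly
  W = xpow (M ∸ 1 ∸ d) *ₚ recip V

  length-V : length V ≡ a
  length-V = length-tabulate g

  d<a : d < a
  d<a = subst (d <_) length-V (deg<length V (subst (0 <_) (sym length-V) (>-nonZero⁻¹ a)))

  -- entries are < 4, so vanishing mod 4 above the degree is vanishing
  V-above-deg : ∀ j → d < j → coeff V j ≡ 0
  V-above-deg j lt = trans (sym (m<n⇒m%n≡m (coeff-tabulate-<4 a g g<4 j))) (coeff-above-deg V j lt)

  pad+d : M ∸ 1 ∸ d + d ≡ M ∸ 1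
  pad+d = m∸n+n≡m (<M⇒≤M∸1 (≤-trans d<a a≤M))

  length-taken : length (take (suc d) V) ≡ suc d
  length-taken = trans (length-take (suc d) V) (m≤n⇒m⊓n≡m (subst (suc d ≤_) (sym length-V) d<a))

  recip-coeff : ∀ r s → r + s ≡ d → coeff (recip V) r ≡ coeff V s
  recip-coeff r s rs = trans (coeff-reverse (take (suc d) V) r s (trans (cong suc rs) (sym length-taken)))
                             (coeff-take (suc d) V s (s≤s (m+n≤o⇒n≤o r (≤-reflexive rs))))

  recip-beyond : ∀ r → d < r → coeff (recip V) r ≡ 0
  recip-beyond r lt =
    coeff-beyond (reverse (take (suc d) V)) r
      (subst (_≤ r) (sym (trans (length-reverse (take (suc d) V)) length-taken)) lt)

  coeff-W-reversed : ∀ i s → i + s ≡ M ∸ 1 → coeff W i ≡ coeff V s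
  coeff-W-reversed i s is with M ∸ 1 ∸ d ≤? i
  ... | yes e≤i = trans (cong (coeff W) (sym e+r)) (trans (coeff-xpow*ₚ-above e (recip V) r) (recip-coeff r s r+s))
    where
    e = M ∸ 1 ∸ d
    r = i ∸ e
    e+r : e + r ≡ i
    e+r = m+[n∸m]≡n e≤i
    r+s : r + s ≡ d
    r+s = +-cancelˡ-≡ e _ _ (trans (sym (+-assoc e r s)) (trans (cong (_+ s) e+r) (trans is (sym pad+d))))
  ... | no e≰i with d <? s
  ...   | yes d<s = trans (coeff-xpow*ₚ-below _ (recip V) i (≰⇒> e≰i)) (sym (V-above-deg s d<s))
  ...   | no d≮s  = ⊥-elim (<-irrefl (trans is (sym pad+d)) (+-mono-<-≤ (≰⇒> e≰i) (≮⇒≥ d≮s)))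

  coeff-W-beyond : ∀ i → M ≤ i → coeff W i ≡ 0
  coeff-W-beyond i M≤i =
    trans (cong (coeff W) (sym e+r)) (trans (coeff-xpow*ₚ-above e (recip V) r) (recip-beyond r d<r))
    where
    e = M ∸ 1 ∸ d
    e≤i : e ≤ i
    e≤i = ≤-trans (m∸n≤m (M ∸ 1) d) (≤-trans (m∸n≤m M 1) M≤i)
    r = i ∸ e
    e+r : e + r ≡ i
    e+r = m+[n∸m]≡n e≤i
    d<r : d < r
    d<r = +-cancelˡ-< e d r (subst (e + d <_) (sym e+r) (subst (_< i) (sym pad+d) (<-≤-trans M∸1<M M≤i)))

module HalfProduct (M : ℕ) {{_ : NonZero M}} (k : ℕ) (k<M : k < M) where
  open Residues M
  open Reduction M k

  R-padded : ∀ a {{_ : NonZero a}} (a≤M : a ≤ M) (g : Fin a → ℕ) (g<4 : ∀ x → g x < 4) c →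
             let open PaddedReciprocal M a a≤M g g<4 in
             R (c % M) W ≡ coeff V ((M ∸ 1 ∸ k + c) % M)
  R-padded a a≤M g g<4 c =
    trans (R-short W M ≤-refl coeff-W-beyond (c % M) j (m%n<n c M) j<M hits-k) (coeff-W-reversed j z j+z)
    where
    open PaddedReciprocal M a a≤M g g<4
    σ = M ∸ 1 ∸ k
    z = (σ + c) % M
    j = M ∸ 1 ∸ z
    j+z : j + z ≡ M ∸ 1
    j+z = m∸n+n≡m (<M⇒≤M∸1 (m%n<n (σ + c) M))
    j<M : j < M
    j<M = ≤-<-trans (m∸n≤m (M ∸ 1) z) M∸1<M
    same-after-z : (c % M + j + z) % M ≡ (k + z) % M
    same-after-z = begin
        (c % M + j + z) % M
      ≡⟨ cong (_% M) (trans (+-assoc (c % M) j z) (cong (c % M +_) j+z)) ⟩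
        (c % M + (M ∸ 1)) % M
      ≡⟨ %-absorbˡ c (M ∸ 1) ⟩
        (c + (M ∸ 1)) % M
      ≡⟨ cong (_% M) (trans (+-comm c (M ∸ 1)) (cong (_+ c) (sym (m+[n∸m]≡n (<M⇒≤M∸1 k<M))))) ⟩
        (k + σ + c) % M
      ≡⟨ cong (_% M) (+-assoc k σ c) ⟩
        (k + (σ + c)) % M
      ≡⟨ sym (%-absorbʳ k (σ + c)) ⟩
        (k + z) % M ∎
      where open ≡-Reasoning
    hits-k : (c % M + j) % M ≡ k
    hits-k = trans (%-cancelʳ-+ (c % M + j) k z same-after-z) (m<n⇒m%n≡m k<M)

  half-product : ∀ a {{_ : NonZero a}} → a ∣ℕ M → (f g : Fin a → ℕ) → (∀ x → g x < 4) →
    R 0 (tabulate f *ₚ (θ (M / a) a *ₚ (xpow (M ∸ 1 ∸ deg (tabulate g)) *ₚ recip (tabulate g))))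
    ≡ sum (tabulate (λ j → f j * g ((toℕ j + (M ∸ 1 ∸ k)) mod a)))
  half-product a a∣M f g g<4 = begin
      R 0 (tabulate f *ₚ (Θ *ₚ W))
    ≡⟨ cong (λ t → R t (tabulate f *ₚ (Θ *ₚ W))) (sym (m<n⇒m%n≡m (>-nonZero⁻¹ M))) ⟩
      R (0 % M) (tabulate f *ₚ (Θ *ₚ W))
    ≡⟨ R-*ₚ (tabulate f) (Θ *ₚ W) 0 ⟩
      convolve (tabulate f) (Θ *ₚ W) 0
    ≡⟨ convolve-tabulate a f (Θ *ₚ W) 0 ⟩
      sum (tabulate (λ j → f j * R (toℕ j % M) (Θ *ₚ W)))
    ≡⟨ cong sum (tabulate-cong (λ j → cong (f j *_) (term j))) ⟩
      sum (tabulate (λ j → f j * g ((toℕ j + σ) mod a))) ∎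
    where
    open ≡-Reasoning
    a≤M = ∣⇒≤ a∣M
    open PaddedReciprocal M a a≤M g g<4
    σ = M ∸ 1 ∸ k
    Θ = θ (M / a) a
    term : ∀ j → R (toℕ j % M) (Θ *ₚ W) ≡ g ((toℕ j + σ) mod a)
    term j = begin
        R (toℕ j % M) (Θ *ₚ W)
      ≡⟨ R-*ₚ Θ W (toℕ j) ⟩
        convolve Θ W (toℕ j)
      ≡⟨ convolve-θ (M / a) a W (toℕ j) ⟩
        sumTo (M / a) (λ r → R ((toℕ j + a * r) % M) W)
      ≡⟨ sumTo-cong (M / a) _ _ (λ r _ → trans (R-padded a a≤M g g<4 (toℕ j + a * r))
                                               (cong (λ t → coeff V (t % M)) (sym (+-assoc σ (toℕ j) (a * r))))) ⟩
        sumTo (M / a) (λ r → coeff V ((σ + toℕ j + a * r) % M))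
      ≡⟨ orbit-sum a (M / a) (m/n*n≡m a∣M) (coeff V)
                   (λ i a≤i → coeff-beyond V i (subst (_≤ i) (sym length-V) a≤i)) (σ + toℕ j) ⟩
        coeff V ((σ + toℕ j) % a)
      ≡⟨ cong (coeff V) (trans (cong (_% a) (+-comm σ (toℕ j))) (sym (toℕ-fromℕ< (m%n<n (toℕ j + σ) a)))) ⟩
        coeff V (toℕ ((toℕ j + σ) mod a))
      ≡⟨ coeff-tabulate a g _ ⟩
        g ((toℕ j + σ) mod a) ∎

lcm-nonZero : ∀ α β {{_ : NonZero α}} {{_ : NonZero β}} → NonZero (lcm α β)
lcm-nonZero α β = ≢-nonZero λ lcm≡0 → ≢-nonZero⁻¹ (α * β) {{m*n≢0 α β}}
  (trans (sym (gcd*lcm α β)) (trans (cong (gcd α β *_) lcm≡0) (*-zeroʳ (gcd α β))))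

circ-coefficient : ∀ α β {{_ : NonZero α}} {{_ : NonZero β}} (u v : Z2Z4 α β) k → k < 𝔪 α β →
                   redAux (𝔪 α β) 0 (circ u v) k ≡ innerℕ u (shift (𝔪 α β ∸ 1 ∸ k) v)
circ-coefficient α β u v k k<M = begin
    R 0 (scaleₚ 2 binary +ₚ quaternary)
  ≡⟨ R-+ₚ 0 (scaleₚ 2 binary) quaternary ⟩
    R 0 (scaleₚ 2 binary) + R 0 quaternary
  ≡⟨ cong (_+ R 0 quaternary) (R-scaleₚ 0 2 binary) ⟩
    2 * R 0 binary + R 0 quaternary
  ≡⟨ cong₂ (λ x y → 2 * x + y)
       (half-product α (m∣lcm[m,n] α β) (toℕ ∘ bin u) (toℕ ∘ bin v) (λ x → bit<4 (bin v x)))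
       (half-product β (n∣lcm[m,n] α β) (toℕ ∘ quat u) (toℕ ∘ quat v) (λ x → toℕ<n (quat v x))) ⟩
    innerℕ u (shift (M ∸ 1 ∸ k) v) ∎
  where
  open ≡-Reasoning
  M = 𝔪 α β
  instance
    M-nonZero : NonZero M
    M-nonZero = lcm-nonZero α β
  open Reduction M k
  open HalfProduct M k k<M
  binary quaternary : Poly
  binary = binPoly (bin u) *ₚ (θ (M / α) α *ₚ (xpow (M ∸ 1 ∸ deg (binPoly (bin v))) *ₚ recip (binPoly (bin v))))
  quaternary = quatPoly (quat u) *ₚ (θ (M / β) β *ₚ (xpow (M ∸ 1 ∸ deg (quatPoly (quat v))) *ₚ recip (quatPoly (quat v))))
  bit<4 : ∀ (x : Fin 2) → toℕ x < 4
  bit<4 x = ≤-trans (toℕ<n x) (s≤s (s≤s z≤n))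

shift-index-mod : ∀ a M {{_ : NonZero a}} {{_ : NonZero M}} → a ∣ℕ M → ∀ (j : Fin a) i →
                  (toℕ j + i) mod a ≡ (toℕ j + i % M) mod a
shift-index-mod a M a∣M j i = toℕ-injective (begin
    toℕ ((toℕ j + i) mod a)      ≡⟨ toℕ-fromℕ< _ ⟩
    (toℕ j + i) % a              ≡⟨ %-distribˡ-+ (toℕ j) i a ⟩
    (toℕ j % a + i % a) % a      ≡⟨ cong (λ t → (toℕ j % a + t) % a) (sym (m∣n⇒o%n%m≡o%m a M i a∣M)) ⟩
    (toℕ j % a + i % M % a) % a  ≡⟨ sym (%-distribˡ-+ (toℕ j) (i % M) a) ⟩
    (toℕ j + i % M) % a          ≡⟨ sym (toℕ-fromℕ< _) ⟩
    toℕ ((toℕ j + i % M) mod a)  ∎)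
  where open ≡-Reasoning

inner-shift-mod : ∀ α β {{_ : NonZero α}} {{_ : NonZero β}} M {{_ : NonZero M}} → α ∣ℕ M → β ∣ℕ M →
                  ∀ (u v : Z2Z4 α β) i → innerℕ u (shift i v) ≡ innerℕ u (shift (i % M) v)
inner-shift-mod α β M α∣M β∣M u v i = cong₂ _+_
  (cong (λ t → 2 * sum t) (tabulate-cong (λ j → cong (λ t → toℕ (bin u j) * toℕ (bin v t))
      (shift-index-mod α M α∣M j i))))
  (cong sum (tabulate-cong (λ j → cong (λ t → toℕ (quat u j) * toℕ (quat v t))
      (shift-index-mod β M β∣M j i))))

mainTheorem5 : (α β : ℕ) {{_ : NonZero α}} {{_ : NonZero β}} (u v : Z2Z4 α β) →
    ((∀ (i : ℕ) → Orthogonal u (shift i v)) ⇔ IsZeroMod (𝔪 α β) (circ u v))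
mainTheorem5 α β u v = mk⇔ orthogonal⇒zero zero⇒orthogonal
  where
  M = 𝔪 α β
  instance
    M-nonZero : NonZero M
    M-nonZero = lcm-nonZero α β
  open Residues M using (<M⇒≤M∸1; M∸1<M)

  -- the coefficient of x^k is the inner product with the shift by M-1-k …
  orthogonal⇒zero : (∀ i → Orthogonal u (shift i v)) → IsZeroMod M (circ u v)
  orthogonal⇒zero orth k k<M = trans (cong (_% 4) (circ-coefficient α β u v k k<M)) (orth (M ∸ 1 ∸ k))

  -- … and every shift is, modulo M, of the form M-1-k with k < M.
  zero⇒orthogonal : IsZeroMod M (circ u v) → ∀ i → Orthogonal u (shift i v)
  zero⇒orthogonal vanishes i = trans (cong (_% 4) inner≡coefficient) (vanishes k k<M)
    where
    k = M ∸ 1 ∸ i % M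
    k<M : k < M
    k<M = ≤-<-trans (m∸n≤m (M ∸ 1) (i % M)) M∸1<M
    inner≡coefficient : innerℕ u (shift i v) ≡ redAux M 0 (circ u v) k
    inner≡coefficient = begin
        innerℕ u (shift i v)
      ≡⟨ inner-shift-mod α β M (m∣lcm[m,n] α β) (n∣lcm[m,n] α β) u v i ⟩
        innerℕ u (shift (i % M) v)
      ≡⟨ cong (λ t → innerℕ u (shift t v)) (sym (m∸[m∸n]≡n (<M⇒≤M∸1 (m%n<n i M)))) ⟩
        innerℕ u (shift (M ∸ 1 ∸ k) v)
      ≡⟨ sym (circ-coefficient α β u v k k<M) ⟩
        redAux M 0 (circ u v) k ∎
      where open ≡-Reasoning
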